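{- Let $g$ be a positive integer and $s,t$ integers. Then there exists an integer $z$ with $s<zg<t$ if and only if for every integer $y$ with $-s^2-t^2-2<y\le s^2+t^2+2$ one has $(y-1)g-s>0$ or $t-yg>0$. -}

module Defs where

module Submission where

-- Write B = s*s + t*t + 2 and call "(y-1)g > s or yg < t" the test at y.
--
-- (⇒) If s < zg < t, the test passes at every y, not only in the window:
--     for y ≤ z we get yg ≤ zg < t, and for y > z we get (y-1)g ≥ zg > s
--     (`multiple⇒test`).
-- (⇐) Let q = ⌊s/g⌋, so qg ≤ s < (q+1)g (`floor-multiple`).  A multiplier m
--     with mg ≤ s satisfies m ≤ s*s, and one with s < mg satisfies
--     -(s*s) < m (`multiplier-upper`, `multiplier-lower`); hence y = q+1 lies
--     in the window (-B, B].  The test at y cannot pass through (y-1)g = qg > s,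
--     so it gives yg < t, and z = y is a multiple strictly between s and t
--     (`test⇒multiple`).

open import Defs
open import Data.Integer using (ℤ; +_; _+_; _-_; _*_; -_; _<_; _≤_)
open import Data.Product using (Σ; _×_)
open import Data.Sum using (_⊎_)

open import Data.Integer.Base
  using (+[1+_]; -[1+_]; +≤+; +<+; -≤+; -1ℤ; nonNegative; nonPositive)
  renaming (suc to sucℤ)
open import Data.Integer.Properties
open import Data.Integer.DivMod using (_/ℕ_; _%ℕ_; a≡a%ℕn+[a/ℕn]*n; n<s[n/ℕd]*d)
open import Data.Integer.Tactic.RingSolver using (solve-∀)
open import Data.Nat using (suc; z≤n; s≤s)
import Data.Nat.Properties as ℕ
open import Data.Product using (_,_)
open import Data.Sum using (inj₁; inj₂)
open import Relation.Nullary using (yes; no)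
open import Relation.Nullary.Negation using (contradiction)
open import Relation.Binary.PropositionalEquality using (_≡_; sym; trans; subst; subst₂)

<⇒0<- : ∀ {a b} → b < a → + 0 < a - b
<⇒0<- {a} {b} b<a = subst (_< a - b) (+-inverseʳ b) (+-monoˡ-< (- b) b<a)

0<-⇒< : ∀ {a b} → + 0 < a - b → b < a
0<-⇒< {a} {b} 0<a-b = subst₂ _<_ (+-identityˡ b) (minus-plus a b) (+-monoˡ-< b 0<a-b)
  where
  minus-plus : ∀ a b → a - b + b ≡ a
  minus-plus = solve-∀

0≤i*i : ∀ i → + 0 ≤ i * i
0≤i*i (+ 0)    = +≤+ z≤n
0≤i*i +[1+ n ] = +≤+ z≤n
0≤i*i -[1+ n ] = +≤+ z≤n

i≤i*i : ∀ i → i ≤ i * i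
i≤i*i (+ 0)    = +≤+ z≤n
i≤i*i +[1+ n ] = +≤+ (ℕ.m≤m*n (suc n) (suc n))
i≤i*i -[1+ n ] = -≤+

-i≤i*i : ∀ i → - i ≤ i * i
-i≤i*i (+ 0)     = +≤+ z≤n
-i≤i*i +[1+ n ]  = -≤+
-i≤i*i -[1+ n ]  = +≤+ (ℕ.m≤m*n (suc n) (suc n))

-[i*i]≤i : ∀ i → - (i * i) ≤ i
-[i*i]≤i i = subst (- (i * i) ≤_) (neg-involutive i) (neg-mono-≤ (-i≤i*i i))

i≤i*g : ∀ {g} i → + 0 < g → + 0 ≤ i → i ≤ i * g
i≤i*g {g} i 0<g 0≤i =
  subst (_≤ i * g) (*-identityʳ i) (*-monoˡ-≤-nonNeg i {{nonNegative 0≤i}} (i<j⇒suc[i]≤j 0<g))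

i*g≤i : ∀ {g} i → + 0 < g → i ≤ + 0 → i * g ≤ i
i*g≤i {g} i 0<g i≤0 =
  subst (i * g ≤_) (*-identityʳ i) (*-monoˡ-≤-nonPos i {{nonPositive i≤0}} (i<j⇒suc[i]≤j 0<g))

*-pos-mono-≤ : ∀ {g y z} → + 0 < g → y ≤ z → y * g ≤ z * g
*-pos-mono-≤ {g} 0<g = *-monoʳ-≤-nonNeg g {{nonNegative (<⇒≤ 0<g)}}

floor-multiple : ∀ g s → + 0 < g → Σ ℤ λ q → q * g ≤ s × s < sucℤ q * g
floor-multiple (+ 0)    s (+<+ ())
floor-multiple +[1+ k ] s _ = s /ℕ suc k , qg≤s , n<s[n/ℕd]*d s (suc k)
  where
  qg≤s : (s /ℕ suc k) * +[1+ k ] ≤ s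
  qg≤s = subst ((s /ℕ suc k) * +[1+ k ] ≤_) (sym (a≡a%ℕn+[a/ℕn]*n s (suc k)))
           (i≤j+i _ (+ (s %ℕ suc k)))

multiplier-upper : ∀ {g m s} → + 0 < g → m * g ≤ s → m ≤ s * s
multiplier-upper {g} {m} {s} 0<g mg≤s with + 0 ≤? m
... | yes 0≤m = ≤-trans (i≤i*g m 0<g 0≤m) (≤-trans mg≤s (i≤i*i s))
... | no  m≱0 = ≤-trans (<⇒≤ (≰⇒> m≱0)) (0≤i*i s)

multiplier-lower : ∀ {g m s} → + 0 < g → s < m * g → - (s * s) < m
multiplier-lower {g} {m} {s} 0<g s<mg with + 0 <? m
... | yes 0<m = ≤-<-trans (neg-mono-≤ (0≤i*i s)) 0<m
... | no  m≯0 = <-≤-trans (≤-<-trans (-[i*i]≤i s) s<mg) (i*g≤i m 0<g (≮⇒≥ m≯0))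

window-lower : ∀ s t → - (s * s) - t * t - + 2 ≤ - (s * s)
window-lower s t =
  ≤-trans (i-j≤i _ (+ 2)) (i-j≤i (- (s * s)) (t * t) {{nonNegative (0≤i*i t)}})

window-upper : ∀ s t → sucℤ (s * s) ≤ s * s + t * t + + 2
window-upper s t = ≤-trans (≤-reflexive (+-comm (+ 1) (s * s)))
  (+-mono-≤ (i≤i+j (s * s) (t * t) {{nonNegative (0≤i*i t)}}) (+≤+ (s≤s z≤n)))

MultipleBetween : ℤ → ℤ → ℤ → Set
MultipleBetween g s t = Σ ℤ λ z → (s < z * g) × (z * g < t)

Test : ℤ → ℤ → ℤ → ℤ → Set
Test g s t y = (+ 0 < (y - + 1) * g - s) ⊎ (+ 0 < t - y * g)

TestsInWindow : ℤ → ℤ → ℤ → Set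
TestsInWindow g s t =
  (y : ℤ) → (- (s * s) - t * t - + 2) < y → y ≤ s * s + t * t + + 2 → Test g s t y

multiple⇒test : ∀ {g s t} → + 0 < g → MultipleBetween g s t → ∀ y → Test g s t y
multiple⇒test {g} 0<g (z , s<zg , zg<t) y with y ≤? z
... | yes y≤z = inj₂ (<⇒0<- (≤-<-trans (*-pos-mono-≤ 0<g y≤z) zg<t))
... | no  y≰z = inj₁ (<⇒0<- (<-≤-trans s<zg (*-pos-mono-≤ 0<g z≤y-1)))
  where
  -- z < y gives z ≤ pred y, and pred y is -1 + y.
  z≤y-1 : z ≤ y - + 1
  z≤y-1 = subst (z ≤_) (+-comm -1ℤ y) (i<j⇒i≤pred[j] (≰⇒> y≰z))

test⇒multiple : ∀ {g s t} → + 0 < g → TestsInWindow g s t → MultipleBetween g s t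
test⇒multiple {g} {s} {t} 0<g tests with floor-multiple g s 0<g
... | q , qg≤s , s<[q+1]g
    with tests (sucℤ q) (≤-<-trans (window-lower s t) (multiplier-lower 0<g s<[q+1]g))
                        (≤-trans (suc-mono (multiplier-upper {g} {q} {s} 0<g qg≤s)) (window-upper s t))
...   | inj₁ 0<qg-s = contradiction (subst (λ m → s < m * g) q+1-1≡q (0<-⇒< 0<qg-s)) (≤⇒≯ qg≤s)
  where
  -- sucℤ q - 1 is (1 + q) + -1, and pred (sucℤ q) is -1 + (1 + q).
  q+1-1≡q : sucℤ q - + 1 ≡ q
  q+1-1≡q = trans (+-comm (sucℤ q) -1ℤ) (pred-suc q)
...   | inj₂ 0<t-[q+1]g = sucℤ q , s<[q+1]g , 0<-⇒< 0<t-[q+1]g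

lemma3 : (g s t : ℤ) → + 0 < g →
    ((Σ ℤ λ z → (s < z * g) × (z * g < t)) →
    ((y : ℤ) → (- (s * s) - t * t - + 2) < y → y ≤ s * s + t * t + + 2 →
    (+ 0 < (y - + 1) * g - s) ⊎ (+ 0 < t - y * g)))
    × (((y : ℤ) → (- (s * s) - t * t - + 2) < y → y ≤ s * s + t * t + + 2 →
    (+ 0 < (y - + 1) * g - s) ⊎ (+ 0 < t - y * g)) →
    Σ ℤ λ z → (s < z * g) × (z * g < t))
lemma3 g s t 0<g = (λ between y _ _ → multiple⇒test 0<g between y) , test⇒multiple 0<g
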